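{- For any $\Sigma$-formula $S(p)$ there is an $\mathcal{L}''$-formula $F$ containing only predicate symbols, propositional variables and free variables occurring in $S$, not containing $p$, such that $\mathbf{QGL}\vdash F\leftrightarrow S(F)$.
   Context: $\mathcal{L}''$ is the predicate modal language with individual variables, constants $\top,\bot$, connectives $\neg,\to,\lor,\land$, quantifiers $\forall,\exists$, modal operator $\Box$, countably many predicate symbols of each arity, and countably infinitely many propositional variables $p,q,\ldots$. $S(F)$ denotes replacing every occurrence of the propositional variable $p$ in $S(p)$ by $F$. $\mathbf{QGL}$ (over $\mathcal{L}''$): all instances of the axioms of classical first-order predicate logic, $\Box(A\to B)\to(\Box A\to\Box B)$, $\Box A\to\Box\Box A$, $\Box(\Box A\to A)\to\Box A$, with rules modus ponens, generalization and necessitation. $\Sigma$-formulas: every formula $\Box B$ is a $\Sigma$-formula, and if $B,C$ are $\Sigma$-formulas then so are $B\lor C$, $B\land C$, $\exists u B$. Standing convention: formulas are taken (after renaming bound variables) so that no variable occurs both free and bound in a formula. -}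

module Defs where

open import Data.Nat using (ℕ; _≡ᵇ_)
open import Data.Bool using (Bool; true; false; not; _∧_; _∨_; if_then_else_)
open import Data.Vec using (Vec; map)
open import Data.Vec.Membership.Propositional using () renaming (_∈_ to _∈ᵥ_)
open import Data.Product using (_×_)
open import Data.Sum using (_⊎_)
open import Data.Unit using () renaming (⊤ to Unit)
open import Relation.Nullary using (¬_)
open import Relation.Binary.PropositionalEquality using (_≡_)

-- Individual variables, propositional variables and predicate names are
-- indexed by ℕ; a predicate symbol is a pair (arity n, name i), so there
-- are countably many predicate symbols of each arity.  There are no
-- function symbols or individual constants: the only terms are variables.

Var : Set
Var = ℕ

infixr 6 _⇒_
infixr 7 _∨ᶠ_
infixr 8 _∧ᶠ_

data Formula : Set where
  ⊤ᶠ   : Formula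
  ⊥ᶠ   : Formula
  pvar : ℕ → Formula
  atom : (n i : ℕ) → Vec Var n → Formula
  ¬ᶠ_  : Formula → Formula
  _⇒_  : Formula → Formula → Formula
  _∨ᶠ_ : Formula → Formula → Formula
  _∧ᶠ_ : Formula → Formula → Formula
  ∀ᶠ   : Var → Formula → Formula
  ∃ᶠ   : Var → Formula → Formula
  □_   : Formula → Formula

_⇔_ : Formula → Formula → Formula
A ⇔ B = (A ⇒ B) ∧ᶠ (B ⇒ A)

data _∈FV_ (x : Var) : Formula → Set where
  atom : ∀ {n i vs} → x ∈ᵥ vs → x ∈FV atom n i vs
  ¬ᶠ_  : ∀ {A} → x ∈FV A → x ∈FV (¬ᶠ A)
  ⇒ˡ   : ∀ {A B} → x ∈FV A → x ∈FV (A ⇒ B)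
  ⇒ʳ   : ∀ {A B} → x ∈FV B → x ∈FV (A ⇒ B)
  ∨ˡ   : ∀ {A B} → x ∈FV A → x ∈FV (A ∨ᶠ B)
  ∨ʳ   : ∀ {A B} → x ∈FV B → x ∈FV (A ∨ᶠ B)
  ∧ˡ   : ∀ {A B} → x ∈FV A → x ∈FV (A ∧ᶠ B)
  ∧ʳ   : ∀ {A B} → x ∈FV B → x ∈FV (A ∧ᶠ B)
  ∀ᶠ   : ∀ {y A} → ¬ (x ≡ y) → x ∈FV A → x ∈FV ∀ᶠ y A
  ∃ᶠ   : ∀ {y A} → ¬ (x ≡ y) → x ∈FV A → x ∈FV ∃ᶠ y A
  □_   : ∀ {A} → x ∈FV A → x ∈FV (□ A)

data BoundIn (x : Var) : Formula → Set where
  ¬ᶠ_  : ∀ {A} → BoundIn x A → BoundIn x (¬ᶠ A)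
  ⇒ˡ   : ∀ {A B} → BoundIn x A → BoundIn x (A ⇒ B)
  ⇒ʳ   : ∀ {A B} → BoundIn x B → BoundIn x (A ⇒ B)
  ∨ˡ   : ∀ {A B} → BoundIn x A → BoundIn x (A ∨ᶠ B)
  ∨ʳ   : ∀ {A B} → BoundIn x B → BoundIn x (A ∨ᶠ B)
  ∧ˡ   : ∀ {A B} → BoundIn x A → BoundIn x (A ∧ᶠ B)
  ∧ʳ   : ∀ {A B} → BoundIn x B → BoundIn x (A ∧ᶠ B)
  ∀here : ∀ {A} → BoundIn x (∀ᶠ x A)
  ∃here : ∀ {A} → BoundIn x (∃ᶠ x A)
  ∀ᶠ   : ∀ {y A} → BoundIn x A → BoundIn x (∀ᶠ y A)
  ∃ᶠ   : ∀ {y A} → BoundIn x A → BoundIn x (∃ᶠ y A)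
  □_   : ∀ {A} → BoundIn x A → BoundIn x (□ A)

data PredIn (n i : ℕ) : Formula → Set where
  atom : ∀ {vs} → PredIn n i (atom n i vs)
  ¬ᶠ_  : ∀ {A} → PredIn n i A → PredIn n i (¬ᶠ A)
  ⇒ˡ   : ∀ {A B} → PredIn n i A → PredIn n i (A ⇒ B)
  ⇒ʳ   : ∀ {A B} → PredIn n i B → PredIn n i (A ⇒ B)
  ∨ˡ   : ∀ {A B} → PredIn n i A → PredIn n i (A ∨ᶠ B)
  ∨ʳ   : ∀ {A B} → PredIn n i B → PredIn n i (A ∨ᶠ B)
  ∧ˡ   : ∀ {A B} → PredIn n i A → PredIn n i (A ∧ᶠ B)
  ∧ʳ   : ∀ {A B} → PredIn n i B → PredIn n i (A ∧ᶠ B)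
  ∀ᶠ   : ∀ {y A} → PredIn n i A → PredIn n i (∀ᶠ y A)
  ∃ᶠ   : ∀ {y A} → PredIn n i A → PredIn n i (∃ᶠ y A)
  □_   : ∀ {A} → PredIn n i A → PredIn n i (□ A)

data PVarIn (q : ℕ) : Formula → Set where
  pvar : PVarIn q (pvar q)
  ¬ᶠ_  : ∀ {A} → PVarIn q A → PVarIn q (¬ᶠ A)
  ⇒ˡ   : ∀ {A B} → PVarIn q A → PVarIn q (A ⇒ B)
  ⇒ʳ   : ∀ {A B} → PVarIn q B → PVarIn q (A ⇒ B)
  ∨ˡ   : ∀ {A B} → PVarIn q A → PVarIn q (A ∨ᶠ B)
  ∨ʳ   : ∀ {A B} → PVarIn q B → PVarIn q (A ∨ᶠ B)
  ∧ˡ   : ∀ {A B} → PVarIn q A → PVarIn q (A ∧ᶠ B)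
  ∧ʳ   : ∀ {A B} → PVarIn q B → PVarIn q (A ∧ᶠ B)
  ∀ᶠ   : ∀ {y A} → PVarIn q A → PVarIn q (∀ᶠ y A)
  ∃ᶠ   : ∀ {y A} → PVarIn q A → PVarIn q (∃ᶠ y A)
  □_   : ∀ {A} → PVarIn q A → PVarIn q (□ A)

-- standing convention: no variable occurs both free and bound
Clean : Formula → Set
Clean A = ∀ x → x ∈FV A → ¬ BoundIn x A

_[_≔_] : Formula → ℕ → Formula → Formula
⊤ᶠ [ p ≔ F ] = ⊤ᶠ
⊥ᶠ [ p ≔ F ] = ⊥ᶠ
pvar q [ p ≔ F ] = if q ≡ᵇ p then F else pvar q
atom n i vs [ p ≔ F ] = atom n i vs
(¬ᶠ A) [ p ≔ F ] = ¬ᶠ (A [ p ≔ F ])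
(A ⇒ B) [ p ≔ F ] = (A [ p ≔ F ]) ⇒ (B [ p ≔ F ])
(A ∨ᶠ B) [ p ≔ F ] = (A [ p ≔ F ]) ∨ᶠ (B [ p ≔ F ])
(A ∧ᶠ B) [ p ≔ F ] = (A [ p ≔ F ]) ∧ᶠ (B [ p ≔ F ])
∀ᶠ x A [ p ≔ F ] = ∀ᶠ x (A [ p ≔ F ])
∃ᶠ x A [ p ≔ F ] = ∃ᶠ x (A [ p ≔ F ])
(□ A) [ p ≔ F ] = □ (A [ p ≔ F ])

_⟨_/_⟩ : Formula → Var → Var → Formula
⊤ᶠ ⟨ y / x ⟩ = ⊤ᶠ
⊥ᶠ ⟨ y / x ⟩ = ⊥ᶠ
pvar q ⟨ y / x ⟩ = pvar q
atom n i vs ⟨ y / x ⟩ = atom n i (map (λ v → if v ≡ᵇ x then y else v) vs)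
(¬ᶠ A) ⟨ y / x ⟩ = ¬ᶠ (A ⟨ y / x ⟩)
(A ⇒ B) ⟨ y / x ⟩ = (A ⟨ y / x ⟩) ⇒ (B ⟨ y / x ⟩)
(A ∨ᶠ B) ⟨ y / x ⟩ = (A ⟨ y / x ⟩) ∨ᶠ (B ⟨ y / x ⟩)
(A ∧ᶠ B) ⟨ y / x ⟩ = (A ⟨ y / x ⟩) ∧ᶠ (B ⟨ y / x ⟩)
∀ᶠ z A ⟨ y / x ⟩ = if z ≡ᵇ x then ∀ᶠ z A else ∀ᶠ z (A ⟨ y / x ⟩)
∃ᶠ z A ⟨ y / x ⟩ = if z ≡ᵇ x then ∃ᶠ z A else ∃ᶠ z (A ⟨ y / x ⟩)
(□ A) ⟨ y / x ⟩ = □ (A ⟨ y / x ⟩)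

FreeFor : Var → Var → Formula → Set
FreeFor y x ⊤ᶠ = Unit
FreeFor y x ⊥ᶠ = Unit
FreeFor y x (pvar q) = Unit
FreeFor y x (atom n i vs) = Unit
FreeFor y x (¬ᶠ A) = FreeFor y x A
FreeFor y x (A ⇒ B) = FreeFor y x A × FreeFor y x B
FreeFor y x (A ∨ᶠ B) = FreeFor y x A × FreeFor y x B
FreeFor y x (A ∧ᶠ B) = FreeFor y x A × FreeFor y x B
FreeFor y x (∀ᶠ z A) = ¬ (x ∈FV ∀ᶠ z A) ⊎ (¬ (z ≡ y) × FreeFor y x A)
FreeFor y x (∃ᶠ z A) = ¬ (x ∈FV ∃ᶠ z A) ⊎ (¬ (z ≡ y) × FreeFor y x A)
FreeFor y x (□ A) = FreeFor y x A

-- Propositional tautologies: formulas true under every Boolean valuation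
-- of their maximal non-propositional subformulas (propositional
-- variables, atoms, quantified and boxed formulas).

eval : (Formula → Bool) → Formula → Bool
eval v ⊤ᶠ = true
eval v ⊥ᶠ = false
eval v (¬ᶠ A) = not (eval v A)
eval v (A ⇒ B) = not (eval v A) ∨ eval v B
eval v (A ∨ᶠ B) = eval v A ∨ eval v B
eval v (A ∧ᶠ B) = eval v A ∧ eval v B
eval v A@(pvar _) = v A
eval v A@(atom _ _ _) = v A
eval v A@(∀ᶠ _ _) = v A
eval v A@(∃ᶠ _ _) = v A
eval v A@(□ _) = v A

Tautology : Formula → Set
Tautology A = ∀ (v : Formula → Bool) → eval v A ≡ true

data QGL⊢_ : Formula → Set where
  taut : ∀ {A} → Tautology A → QGL⊢ A
  ∀-inst : ∀ {x y A} → FreeFor y x A → QGL⊢ (∀ᶠ x A ⇒ A ⟨ y / x ⟩)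
  ∃-intro : ∀ {x y A} → FreeFor y x A → QGL⊢ (A ⟨ y / x ⟩ ⇒ ∃ᶠ x A)
  ∀-dist : ∀ {x A B} → ¬ (x ∈FV B) → QGL⊢ (∀ᶠ x (B ⇒ A) ⇒ (B ⇒ ∀ᶠ x A))
  ∃-elim : ∀ {x A B} → ¬ (x ∈FV B) → QGL⊢ (∀ᶠ x (A ⇒ B) ⇒ (∃ᶠ x A ⇒ B))
  axK : ∀ {A B} → QGL⊢ (□ (A ⇒ B) ⇒ (□ A ⇒ □ B))
  ax4 : ∀ {A} → QGL⊢ (□ A ⇒ □ □ A)
  axL : ∀ {A} → QGL⊢ (□ (□ A ⇒ A) ⇒ □ A)
  mp  : ∀ {A B} → QGL⊢ (A ⇒ B) → QGL⊢ A → QGL⊢ B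
  gen : ∀ {x A} → QGL⊢ A → QGL⊢ ∀ᶠ x A
  nec : ∀ {A} → QGL⊢ A → QGL⊢ (□ A)

data IsΣ : Formula → Set where
  box : ∀ {B} → IsΣ (□ B)
  or  : ∀ {B C} → IsΣ B → IsΣ C → IsΣ (B ∨ᶠ C)
  and : ∀ {B C} → IsΣ B → IsΣ C → IsΣ (B ∧ᶠ C)
  ex  : ∀ {u B} → IsΣ B → IsΣ (∃ᶠ u B)

module Submission where

-- For a Σ-formula S(p) the fixed point is F := S(⊤), obtained by replacing
-- p with ⊤.  The proof combines three general facts about QGL:
--  (1) Σ-formulas are provably self-boxing: QGL ⊢ S → □S.
--  (2) Replacement under a self-boxing hypothesis: if QGL ⊢ H → □H and
--      QGL ⊢ H → (A ↔ B), then QGL ⊢ H → (C(A) ↔ C(B)) for every C that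
--      binds no free variable of H; for a Σ-formula S even
--      QGL ⊢ □H → (S(A) ↔ S(B)), because p can then only occur under □.
--  (3) A Löb-style criterion: if F and S′ are self-boxing and
--      QGL ⊢ □F → (S′ ↔ F), then QGL ⊢ F ↔ S′.
-- With H := F ∧ □F, A := F and B := ⊤, fact (2) gives □F → (S(F) ↔ F), and
-- (3) applied to S′ := S(F) yields F ↔ S(F).

open import Defs
open import Data.Nat using (ℕ; zero; suc; _+_; _≡ᵇ_; _≟_)
open import Data.Nat.Properties using (≡ᵇ⇒≡; ≡⇒≡ᵇ)
open import Data.Bool using (Bool; true; false; not; _∧_; _∨_; if_then_else_; T)
open import Data.Bool.Properties using (T-∧; T-≡)
open import Data.Fin using (Fin; zero; suc)
open import Data.Vec using (Vec; []; _∷_; map; lookup)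
open import Data.Vec.Properties using (lookup-map; map-cong; map-id)
open import Data.Product using (Σ; _×_; _,_; proj₁; proj₂)
import Data.Product as Product
open import Data.Sum using (_⊎_; inj₁; inj₂; fromInj₁; [_,_]′)
import Data.Sum as Sum
open import Data.Unit using (tt)
open import Function.Bundles using (Equivalence)
open import Relation.Nullary using (¬_; yes; no)
open import Relation.Binary.PropositionalEquality

variable
  n : ℕ
  x : Var
  A B C H : Formula

infixr 6 _⊃_
infixr 7 _⋁_
infixr 8 _⋀_
infix  5 _≡ˢ_
infix  9 ~_

data Schema (n : ℕ) : Set where
  ‵_  : Fin n → Schema n
  ⊤ˢ  : Schema n
  ~_  : Schema n → Schema n
  _⊃_ _⋁_ _⋀_ : Schema n → Schema n → Schema n

_≡ˢ_ : Schema n → Schema n → Schema n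
φ ≡ˢ ψ = (φ ⊃ ψ) ⋀ (ψ ⊃ φ)

⟦_⟧ : Schema n → Vec Formula n → Formula
⟦ ‵ i ⟧ σ = lookup σ i
⟦ ⊤ˢ ⟧ σ = ⊤ᶠ
⟦ ~ φ ⟧ σ = ¬ᶠ ⟦ φ ⟧ σ
⟦ φ ⊃ ψ ⟧ σ = ⟦ φ ⟧ σ ⇒ ⟦ ψ ⟧ σ
⟦ φ ⋁ ψ ⟧ σ = ⟦ φ ⟧ σ ∨ᶠ ⟦ ψ ⟧ σ
⟦ φ ⋀ ψ ⟧ σ = ⟦ φ ⟧ σ ∧ᶠ ⟦ ψ ⟧ σ

evalˢ : Vec Bool n → Schema n → Bool
evalˢ ρ (‵ i) = lookup ρ i
evalˢ ρ ⊤ˢ = true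
evalˢ ρ (~ φ) = not (evalˢ ρ φ)
evalˢ ρ (φ ⊃ ψ) = not (evalˢ ρ φ) ∨ evalˢ ρ ψ
evalˢ ρ (φ ⋁ ψ) = evalˢ ρ φ ∨ evalˢ ρ ψ
evalˢ ρ (φ ⋀ ψ) = evalˢ ρ φ ∧ evalˢ ρ ψ

eval-⟦⟧ : ∀ v (σ : Vec Formula n) φ → eval v (⟦ φ ⟧ σ) ≡ evalˢ (map (eval v) σ) φ
eval-⟦⟧ v σ (‵ i) = sym (lookup-map i (eval v) σ)
eval-⟦⟧ v σ ⊤ˢ = refl
eval-⟦⟧ v σ (~ φ) = cong not (eval-⟦⟧ v σ φ)
eval-⟦⟧ v σ (φ ⊃ ψ) = cong₂ (λ a b → not a ∨ b) (eval-⟦⟧ v σ φ) (eval-⟦⟧ v σ ψ)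
eval-⟦⟧ v σ (φ ⋁ ψ) = cong₂ _∨_ (eval-⟦⟧ v σ φ) (eval-⟦⟧ v σ ψ)
eval-⟦⟧ v σ (φ ⋀ ψ) = cong₂ _∧_ (eval-⟦⟧ v σ φ) (eval-⟦⟧ v σ ψ)

everywhere : (Vec Bool n → Bool) → Bool
everywhere {zero} f = f []
everywhere {suc n} f = everywhere (λ ρ → f (true ∷ ρ)) ∧ everywhere (λ ρ → f (false ∷ ρ))

everywhere-sound : (f : Vec Bool n → Bool) → T (everywhere f) → ∀ ρ → T (f ρ)
everywhere-sound f ok [] = ok
everywhere-sound f ok (true ∷ ρ) = everywhere-sound _ (proj₁ (Equivalence.to T-∧ ok)) ρ
everywhere-sound f ok (false ∷ ρ) = everywhere-sound _ (proj₂ (Equivalence.to T-∧ ok)) ρ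

-- Every instance of a schema with a valid truth table is a QGL-theorem.
-- For a concrete schema the validity argument computes to the unit type
-- and is found automatically.
tautology : (φ : Schema n) {valid : T (everywhere (λ ρ → evalˢ ρ φ))} (σ : Vec Formula n) →
            QGL⊢ ⟦ φ ⟧ σ
tautology φ {valid} σ = taut λ v →
  trans (eval-⟦⟧ v σ φ) (Equivalence.to T-≡ (everywhere-sound _ valid (map (eval v) σ)))

α : Schema (suc n)
α = ‵ zero
β : Schema (2 + n)
β = ‵ suc zero
γ : Schema (3 + n)
γ = ‵ suc (suc zero)
δ : Schema (4 + n)
δ = ‵ suc (suc (suc zero))
ε : Schema (5 + n)
ε = ‵ suc (suc (suc (suc zero)))

mp₂ : QGL⊢ (A ⇒ (B ⇒ C)) → QGL⊢ A → QGL⊢ B → QGL⊢ C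
mp₂ t a b = mp (mp t a) b

⇒-id : QGL⊢ (A ⇒ A)
⇒-id {A} = tautology (α ⊃ α) (A ∷ [])

⇒-trans : QGL⊢ (A ⇒ B) → QGL⊢ (B ⇒ C) → QGL⊢ (A ⇒ C)
⇒-trans {A} {B} {C} = mp₂ (tautology ((α ⊃ β) ⊃ (β ⊃ γ) ⊃ (α ⊃ γ)) (A ∷ B ∷ C ∷ []))

⇒-combine : ∀ {P Q R S} → QGL⊢ (P ⇒ Q) → QGL⊢ (P ⇒ R) → QGL⊢ (Q ⇒ (R ⇒ S)) → QGL⊢ (P ⇒ S)
⇒-combine {P} {Q} {R} {S} pq pr qrs =
  mp₂ (mp (tautology ((α ⊃ β) ⊃ (α ⊃ γ) ⊃ (β ⊃ γ ⊃ δ) ⊃ (α ⊃ δ)) (P ∷ Q ∷ R ∷ S ∷ [])) pq) pr qrs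

∧-intro : QGL⊢ A → QGL⊢ B → QGL⊢ (A ∧ᶠ B)
∧-intro {A} {B} = mp₂ (tautology (α ⊃ β ⊃ α ⋀ β) (A ∷ B ∷ []))

∨-cases : QGL⊢ (A ⇒ C) → QGL⊢ (B ⇒ C) → QGL⊢ ((A ∨ᶠ B) ⇒ C)
∨-cases {A} {C} {B} = mp₂ (tautology ((α ⊃ γ) ⊃ (β ⊃ γ) ⊃ (α ⋁ β ⊃ γ)) (A ∷ B ∷ C ∷ []))

löb-rule : QGL⊢ (□ A ⇒ A) → QGL⊢ A
löb-rule step = mp step (mp axL (nec step))

□-mono : QGL⊢ (A ⇒ B) → QGL⊢ (□ A ⇒ □ B)
□-mono h = mp axK (nec h)

□-pair : QGL⊢ (□ A ⇒ (□ B ⇒ □ (A ∧ᶠ B)))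
□-pair {A} {B} = ⇒-trans (□-mono (tautology (α ⊃ β ⊃ α ⋀ β) (A ∷ B ∷ []))) axK

A⟨x/x⟩≡A : ∀ x A → A ⟨ x / x ⟩ ≡ A
A⟨x/x⟩≡A x ⊤ᶠ = refl
A⟨x/x⟩≡A x ⊥ᶠ = refl
A⟨x/x⟩≡A x (pvar q) = refl
A⟨x/x⟩≡A x (atom n i vs) = cong (atom n i) (trans (map-cong rename-self vs) (map-id vs))
  where
  rename-self : ∀ v → (if v ≡ᵇ x then x else v) ≡ v
  rename-self v with v ≡ᵇ x in eq
  ... | true = sym (≡ᵇ⇒≡ v x (subst T (sym eq) tt))
  ... | false = refl
A⟨x/x⟩≡A x (¬ᶠ A) = cong ¬ᶠ_ (A⟨x/x⟩≡A x A)
A⟨x/x⟩≡A x (A ⇒ B) = cong₂ _⇒_ (A⟨x/x⟩≡A x A) (A⟨x/x⟩≡A x B)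
A⟨x/x⟩≡A x (A ∨ᶠ B) = cong₂ _∨ᶠ_ (A⟨x/x⟩≡A x A) (A⟨x/x⟩≡A x B)
A⟨x/x⟩≡A x (A ∧ᶠ B) = cong₂ _∧ᶠ_ (A⟨x/x⟩≡A x A) (A⟨x/x⟩≡A x B)
A⟨x/x⟩≡A x (∀ᶠ z A) with z ≡ᵇ x
... | true = refl
... | false = cong (∀ᶠ z) (A⟨x/x⟩≡A x A)
A⟨x/x⟩≡A x (∃ᶠ z A) with z ≡ᵇ x
... | true = refl
... | false = cong (∃ᶠ z) (A⟨x/x⟩≡A x A)
A⟨x/x⟩≡A x (□ A) = cong □_ (A⟨x/x⟩≡A x A)

freeFor-self : ∀ x A → FreeFor x x A
freeFor-self x ⊤ᶠ = tt
freeFor-self x ⊥ᶠ = tt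
freeFor-self x (pvar q) = tt
freeFor-self x (atom n i vs) = tt
freeFor-self x (¬ᶠ A) = freeFor-self x A
freeFor-self x (A ⇒ B) = freeFor-self x A , freeFor-self x B
freeFor-self x (A ∨ᶠ B) = freeFor-self x A , freeFor-self x B
freeFor-self x (A ∧ᶠ B) = freeFor-self x A , freeFor-self x B
freeFor-self x (∀ᶠ z A) with z ≟ x
... | yes refl = inj₁ λ { (∀ᶠ z≢z _) → z≢z refl }
... | no z≢x = inj₂ (z≢x , freeFor-self x A)
freeFor-self x (∃ᶠ z A) with z ≟ x
... | yes refl = inj₁ λ { (∃ᶠ z≢z _) → z≢z refl }
... | no z≢x = inj₂ (z≢x , freeFor-self x A)
freeFor-self x (□ A) = freeFor-self x A

∀-out : QGL⊢ (∀ᶠ x A ⇒ A)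
∀-out {x} {A} = subst (λ Z → QGL⊢ (∀ᶠ x A ⇒ Z)) (A⟨x/x⟩≡A x A) (∀-inst (freeFor-self x A))

∃-in : QGL⊢ (A ⇒ ∃ᶠ x A)
∃-in {A} {x} = subst (λ Z → QGL⊢ (Z ⇒ ∃ᶠ x A)) (A⟨x/x⟩≡A x A) (∃-intro (freeFor-self x A))

-- For ∀ the
-- implication (H ∧ ∀xA) → B is generalized over x; for ∃ the implication
-- A → (H → ∃xB) is, and the quantifier axioms then move x inside.
∀-mono : ¬ x ∈FV H → QGL⊢ (H ⇒ (A ⇒ B)) → QGL⊢ (H ⇒ (∀ᶠ x A ⇒ ∀ᶠ x B))
∀-mono {x} {H} {A} {B} x∉H h =
  mp (tautology ((α ⋀ β ⊃ γ) ⊃ (α ⊃ β ⊃ γ)) (H ∷ ∀ᶠ x A ∷ ∀ᶠ x B ∷ []))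
     (mp (∀-dist x∉H∧∀A) (gen (⇒-combine (tautology (α ⋀ β ⊃ α) (H ∷ ∀ᶠ x A ∷ []))
                                         (⇒-trans (tautology (α ⋀ β ⊃ β) (H ∷ ∀ᶠ x A ∷ [])) ∀-out)
                                         h)))
  where
  x∉H∧∀A : ¬ x ∈FV (H ∧ᶠ ∀ᶠ x A)
  x∉H∧∀A (∧ˡ k) = x∉H k
  x∉H∧∀A (∧ʳ (∀ᶠ x≢x _)) = x≢x refl

∃-mono : ¬ x ∈FV H → QGL⊢ (H ⇒ (A ⇒ B)) → QGL⊢ (H ⇒ (∃ᶠ x A ⇒ ∃ᶠ x B))
∃-mono {x} {H} {A} {B} x∉H h =
  mp (tautology ((β ⊃ α ⊃ γ) ⊃ (α ⊃ β ⊃ γ)) (H ∷ ∃ᶠ x A ∷ ∃ᶠ x B ∷ []))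
     (mp (∃-elim x∉H⇒∃B) (gen (mp₂ (tautology ((β ⊃ δ) ⊃ (α ⊃ γ ⊃ β) ⊃ (γ ⊃ α ⊃ δ))
                                               (H ∷ B ∷ A ∷ ∃ᶠ x B ∷ []))
                                    ∃-in h)))
  where
  x∉H⇒∃B : ¬ x ∈FV (H ⇒ ∃ᶠ x B)
  x∉H⇒∃B (⇒ˡ k) = x∉H k
  x∉H⇒∃B (⇒ʳ (∃ᶠ x≢x _)) = x≢x refl

□-mono-under : QGL⊢ (H ⇒ (A ⇒ B)) → QGL⊢ (□ H ⇒ (□ A ⇒ □ B))
□-mono-under h = ⇒-trans (□-mono h) axK

⇔-to : QGL⊢ (H ⇒ (A ⇔ B)) → QGL⊢ (H ⇒ (A ⇒ B))
⇔-to {H} {A} {B} = mp (tautology ((α ⊃ (β ≡ˢ γ)) ⊃ (α ⊃ β ⊃ γ)) (H ∷ A ∷ B ∷ []))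

⇔-from : QGL⊢ (H ⇒ (A ⇔ B)) → QGL⊢ (H ⇒ (B ⇒ A))
⇔-from {H} {A} {B} = mp (tautology ((α ⊃ (β ≡ˢ γ)) ⊃ (α ⊃ γ ⊃ β)) (H ∷ A ∷ B ∷ []))

⇔-join : QGL⊢ (H ⇒ (A ⇒ B)) → QGL⊢ (H ⇒ (B ⇒ A)) → QGL⊢ (H ⇒ (A ⇔ B))
⇔-join {H} {A} {B} = mp₂ (tautology ((α ⊃ β ⊃ γ) ⊃ (α ⊃ γ ⊃ β) ⊃ (α ⊃ (β ≡ˢ γ))) (H ∷ A ∷ B ∷ []))

⇔-refl : QGL⊢ (H ⇒ (A ⇔ A))
⇔-refl {H} {A} = tautology (α ⊃ (β ≡ˢ β)) (H ∷ A ∷ [])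

¬-cong : ∀ {A′} → QGL⊢ (H ⇒ (A ⇔ A′)) → QGL⊢ (H ⇒ ((¬ᶠ A) ⇔ (¬ᶠ A′)))
¬-cong {H} {A} {A′} = mp (tautology ((α ⊃ (β ≡ˢ γ)) ⊃ (α ⊃ (~ β ≡ˢ ~ γ))) (H ∷ A ∷ A′ ∷ []))

⇒-cong : ∀ {A′ B′} → QGL⊢ (H ⇒ (A ⇔ A′)) → QGL⊢ (H ⇒ (B ⇔ B′)) →
         QGL⊢ (H ⇒ ((A ⇒ B) ⇔ (A′ ⇒ B′)))
⇒-cong {H} {A} {B} {A′} {B′} = mp₂ (tautology
  ((α ⊃ (β ≡ˢ γ)) ⊃ (α ⊃ (δ ≡ˢ ε)) ⊃ (α ⊃ ((β ⊃ δ) ≡ˢ (γ ⊃ ε)))) (H ∷ A ∷ A′ ∷ B ∷ B′ ∷ []))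

∨-cong : ∀ {A′ B′} → QGL⊢ (H ⇒ (A ⇔ A′)) → QGL⊢ (H ⇒ (B ⇔ B′)) →
         QGL⊢ (H ⇒ ((A ∨ᶠ B) ⇔ (A′ ∨ᶠ B′)))
∨-cong {H} {A} {B} {A′} {B′} = mp₂ (tautology
  ((α ⊃ (β ≡ˢ γ)) ⊃ (α ⊃ (δ ≡ˢ ε)) ⊃ (α ⊃ ((β ⋁ δ) ≡ˢ (γ ⋁ ε)))) (H ∷ A ∷ A′ ∷ B ∷ B′ ∷ []))

∧-cong : ∀ {A′ B′} → QGL⊢ (H ⇒ (A ⇔ A′)) → QGL⊢ (H ⇒ (B ⇔ B′)) →
         QGL⊢ (H ⇒ ((A ∧ᶠ B) ⇔ (A′ ∧ᶠ B′)))
∧-cong {H} {A} {B} {A′} {B′} = mp₂ (tautology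
  ((α ⊃ (β ≡ˢ γ)) ⊃ (α ⊃ (δ ≡ˢ ε)) ⊃ (α ⊃ ((β ⋀ δ) ≡ˢ (γ ⋀ ε)))) (H ∷ A ∷ A′ ∷ B ∷ B′ ∷ []))

∀-cong : ¬ x ∈FV H → QGL⊢ (H ⇒ (A ⇔ B)) → QGL⊢ (H ⇒ (∀ᶠ x A ⇔ ∀ᶠ x B))
∀-cong x∉H h = ⇔-join (∀-mono x∉H (⇔-to h)) (∀-mono x∉H (⇔-from h))

∃-cong : ¬ x ∈FV H → QGL⊢ (H ⇒ (A ⇔ B)) → QGL⊢ (H ⇒ (∃ᶠ x A ⇔ ∃ᶠ x B))
∃-cong x∉H h = ⇔-join (∃-mono x∉H (⇔-to h)) (∃-mono x∉H (⇔-from h))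

□-cong : QGL⊢ (H ⇒ (A ⇔ B)) → QGL⊢ (□ H ⇒ ((□ A) ⇔ (□ B)))
□-cong h = ⇔-join (□-mono-under (⇔-to h)) (□-mono-under (⇔-from h))

NoCapture : Formula → Formula → Set
NoCapture H C = ∀ x → BoundIn x C → ¬ x ∈FV H

module Replacement (p : ℕ) {H A B : Formula}
                   (H-box : QGL⊢ (H ⇒ □ H)) (A⇔B : QGL⊢ (H ⇒ (A ⇔ B))) where

  -- Any formula: since H → □H, the equivalence also passes under boxes.
  replace : ∀ C → NoCapture H C → QGL⊢ (H ⇒ ((C [ p ≔ A ]) ⇔ (C [ p ≔ B ])))
  replace ⊤ᶠ _ = ⇔-refl
  replace ⊥ᶠ _ = ⇔-refl
  replace (pvar q) _ with q ≡ᵇ p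
  ... | true = A⇔B
  ... | false = ⇔-refl
  replace (atom n i vs) _ = ⇔-refl
  replace (¬ᶠ C) nc = ¬-cong (replace C λ x b → nc x (¬ᶠ b))
  replace (C ⇒ D) nc = ⇒-cong (replace C λ x b → nc x (⇒ˡ b)) (replace D λ x b → nc x (⇒ʳ b))
  replace (C ∨ᶠ D) nc = ∨-cong (replace C λ x b → nc x (∨ˡ b)) (replace D λ x b → nc x (∨ʳ b))
  replace (C ∧ᶠ D) nc = ∧-cong (replace C λ x b → nc x (∧ˡ b)) (replace D λ x b → nc x (∧ʳ b))
  replace (∀ᶠ x C) nc = ∀-cong (nc x ∀here) (replace C λ y b → nc y (∀ᶠ b))
  replace (∃ᶠ x C) nc = ∃-cong (nc x ∃here) (replace C λ y b → nc y (∃ᶠ b))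
  replace (□ C) nc = ⇒-trans H-box (□-cong (replace C λ x b → nc x (□ b)))

  -- Σ-formulas: every occurrence of p lies under a □, so □H suffices.
  replaceΣ : ∀ S → IsΣ S → NoCapture H S → QGL⊢ (□ H ⇒ ((S [ p ≔ A ]) ⇔ (S [ p ≔ B ])))
  replaceΣ (□ C) box nc = □-cong (replace C λ x b → nc x (□ b))
  replaceΣ (C ∨ᶠ D) (or σC σD) nc =
    ∨-cong (replaceΣ C σC λ x b → nc x (∨ˡ b)) (replaceΣ D σD λ x b → nc x (∨ʳ b))
  replaceΣ (C ∧ᶠ D) (and σC σD) nc =
    ∧-cong (replaceΣ C σC λ x b → nc x (∧ˡ b)) (replaceΣ D σD λ x b → nc x (∧ʳ b))
  replaceΣ (∃ᶠ u C) (ex σC) nc =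
    ∃-cong (λ { (□ k) → nc u ∃here k }) (replaceΣ C σC λ y b → nc y (∃ᶠ b))

Σ-self-boxing : ∀ {S} → IsΣ S → QGL⊢ (S ⇒ □ S)
Σ-self-boxing box = ax4
Σ-self-boxing (or {B} {C} σB σC) =
  ∨-cases (⇒-trans (Σ-self-boxing σB) (□-mono (tautology (α ⊃ α ⋁ β) (B ∷ C ∷ []))))
          (⇒-trans (Σ-self-boxing σC) (□-mono (tautology (β ⊃ α ⋁ β) (B ∷ C ∷ []))))
Σ-self-boxing (and {B} {C} σB σC) =
  ⇒-combine (⇒-trans (tautology (α ⋀ β ⊃ α) (B ∷ C ∷ [])) (Σ-self-boxing σB))
            (⇒-trans (tautology (α ⋀ β ⊃ β) (B ∷ C ∷ [])) (Σ-self-boxing σC))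
            □-pair
Σ-self-boxing (ex {u} σB) = mp (∃-elim u∉□∃B) (gen (⇒-trans (Σ-self-boxing σB) (□-mono ∃-in)))
  where
  u∉□∃B : ¬ u ∈FV (□ ∃ᶠ u _)
  u∉□∃B (□ (∃ᶠ u≢u _)) = u≢u refl

□-strengthen : ∀ {F} → QGL⊢ (□ F ⇒ □ (F ∧ᶠ □ F))
□-strengthen = ⇒-combine ⇒-id ax4 □-pair

∧□-self-boxing : ∀ {F} → QGL⊢ ((F ∧ᶠ □ F) ⇒ □ (F ∧ᶠ □ F))
∧□-self-boxing {F} = ⇒-trans (tautology (α ⋀ β ⊃ β) (F ∷ □ F ∷ [])) □-strengthen

-- Two self-boxing formulas that agree under □F are equivalent: one
-- direction is immediate, the other follows from Löb's rule.
fixed-point-criterion : ∀ {F S} → QGL⊢ (F ⇒ □ F) → QGL⊢ (S ⇒ □ S) → QGL⊢ (□ F ⇒ (S ⇔ F)) →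
                        QGL⊢ (F ⇔ S)
fixed-point-criterion {F} {S} F-box S-box agree = ∧-intro forward (löb-rule löb-step)
  where
  forward : QGL⊢ (F ⇒ S)
  forward = ⇒-combine F-box ⇒-id (⇔-from agree)

  -- □(S → F) together with S → □S gives □F, hence F from S.
  löb-step : QGL⊢ (□ (S ⇒ F) ⇒ (S ⇒ F))
  löb-step = mp₂ (mp (tautology ((β ⊃ δ) ⊃ (α ⊃ δ ⊃ ε) ⊃ (ε ⊃ (β ≡ˢ γ)) ⊃ (α ⊃ β ⊃ γ))
                                (□ (S ⇒ F) ∷ S ∷ F ∷ □ S ∷ □ F ∷ []))
                     S-box) axK agree

module _ {p : ℕ} {G : Formula} where

  -- Σ-formulas are closed under substitution (p never occurs at Σ-level).
  Σ-subst : ∀ {S} → IsΣ S → IsΣ (S [ p ≔ G ])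
  Σ-subst box = box
  Σ-subst (or σB σC) = or (Σ-subst σB) (Σ-subst σC)
  Σ-subst (and σB σC) = and (Σ-subst σB) (Σ-subst σC)
  Σ-subst (ex σB) = ex (Σ-subst σB)

  ∈FV-subst : ∀ A → x ∈FV (A [ p ≔ G ]) → x ∈FV A ⊎ x ∈FV G
  ∈FV-subst (pvar q) h with q ≡ᵇ p
  ... | true = inj₂ h
  ... | false = inj₁ h
  ∈FV-subst (atom n i vs) h = inj₁ h
  ∈FV-subst (¬ᶠ A) (¬ᶠ h) = Sum.map₁ ¬ᶠ_ (∈FV-subst A h)
  ∈FV-subst (A ⇒ B) (⇒ˡ h) = Sum.map₁ ⇒ˡ (∈FV-subst A h)
  ∈FV-subst (A ⇒ B) (⇒ʳ h) = Sum.map₁ ⇒ʳ (∈FV-subst B h)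
  ∈FV-subst (A ∨ᶠ B) (∨ˡ h) = Sum.map₁ ∨ˡ (∈FV-subst A h)
  ∈FV-subst (A ∨ᶠ B) (∨ʳ h) = Sum.map₁ ∨ʳ (∈FV-subst B h)
  ∈FV-subst (A ∧ᶠ B) (∧ˡ h) = Sum.map₁ ∧ˡ (∈FV-subst A h)
  ∈FV-subst (A ∧ᶠ B) (∧ʳ h) = Sum.map₁ ∧ʳ (∈FV-subst B h)
  ∈FV-subst (∀ᶠ y A) (∀ᶠ x≢y h) = Sum.map₁ (∀ᶠ x≢y) (∈FV-subst A h)
  ∈FV-subst (∃ᶠ y A) (∃ᶠ x≢y h) = Sum.map₁ (∃ᶠ x≢y) (∈FV-subst A h)
  ∈FV-subst (□ A) (□ h) = Sum.map₁ □_ (∈FV-subst A h)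

  PredIn-subst : ∀ {m i} A → PredIn m i (A [ p ≔ G ]) → PredIn m i A ⊎ PredIn m i G
  PredIn-subst (pvar q) h with q ≡ᵇ p
  ... | true = inj₂ h
  ... | false = inj₁ h
  PredIn-subst (atom n i vs) h = inj₁ h
  PredIn-subst (¬ᶠ A) (¬ᶠ h) = Sum.map₁ ¬ᶠ_ (PredIn-subst A h)
  PredIn-subst (A ⇒ B) (⇒ˡ h) = Sum.map₁ ⇒ˡ (PredIn-subst A h)
  PredIn-subst (A ⇒ B) (⇒ʳ h) = Sum.map₁ ⇒ʳ (PredIn-subst B h)
  PredIn-subst (A ∨ᶠ B) (∨ˡ h) = Sum.map₁ ∨ˡ (PredIn-subst A h)
  PredIn-subst (A ∨ᶠ B) (∨ʳ h) = Sum.map₁ ∨ʳ (PredIn-subst B h)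
  PredIn-subst (A ∧ᶠ B) (∧ˡ h) = Sum.map₁ ∧ˡ (PredIn-subst A h)
  PredIn-subst (A ∧ᶠ B) (∧ʳ h) = Sum.map₁ ∧ʳ (PredIn-subst B h)
  PredIn-subst (∀ᶠ y A) (∀ᶠ h) = Sum.map₁ ∀ᶠ (PredIn-subst A h)
  PredIn-subst (∃ᶠ y A) (∃ᶠ h) = Sum.map₁ ∃ᶠ (PredIn-subst A h)
  PredIn-subst (□ A) (□ h) = Sum.map₁ □_ (PredIn-subst A h)

  PVarIn-subst : ∀ {r} A → PVarIn r (A [ p ≔ G ]) → (PVarIn r A × ¬ r ≡ p) ⊎ PVarIn r G
  PVarIn-subst (pvar q) h with q ≡ᵇ p in q≡ᵇp
  PVarIn-subst (pvar q) h | true = inj₂ h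
  PVarIn-subst (pvar q) pvar | false = inj₁ (pvar , λ q≡p → subst T q≡ᵇp (≡⇒≡ᵇ q p q≡p))
  PVarIn-subst (¬ᶠ A) (¬ᶠ h) = Sum.map₁ (Product.map₁ ¬ᶠ_) (PVarIn-subst A h)
  PVarIn-subst (A ⇒ B) (⇒ˡ h) = Sum.map₁ (Product.map₁ ⇒ˡ) (PVarIn-subst A h)
  PVarIn-subst (A ⇒ B) (⇒ʳ h) = Sum.map₁ (Product.map₁ ⇒ʳ) (PVarIn-subst B h)
  PVarIn-subst (A ∨ᶠ B) (∨ˡ h) = Sum.map₁ (Product.map₁ ∨ˡ) (PVarIn-subst A h)
  PVarIn-subst (A ∨ᶠ B) (∨ʳ h) = Sum.map₁ (Product.map₁ ∨ʳ) (PVarIn-subst B h)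
  PVarIn-subst (A ∧ᶠ B) (∧ˡ h) = Sum.map₁ (Product.map₁ ∧ˡ) (PVarIn-subst A h)
  PVarIn-subst (A ∧ᶠ B) (∧ʳ h) = Sum.map₁ (Product.map₁ ∧ʳ) (PVarIn-subst B h)
  PVarIn-subst (∀ᶠ y A) (∀ᶠ h) = Sum.map₁ (Product.map₁ ∀ᶠ) (PVarIn-subst A h)
  PVarIn-subst (∃ᶠ y A) (∃ᶠ h) = Sum.map₁ (Product.map₁ ∃ᶠ) (PVarIn-subst A h)
  PVarIn-subst (□ A) (□ h) = Sum.map₁ (Product.map₁ □_) (PVarIn-subst A h)

lemma6p6 : (p : ℕ) (S : Formula) → IsΣ S → Clean S →
    Σ Formula (λ F →
    (∀ n i → PredIn n i F → PredIn n i S) ×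
    (∀ q → PVarIn q F → PVarIn q S) ×
    ¬ PVarIn p F ×
    (∀ x → x ∈FV F → x ∈FV S) ×
    QGL⊢ (F ⇔ (S [ p ≔ F ])))
lemma6p6 p S σS clean =
    F
  , (λ n i h → fromInj₁ (λ ()) (PredIn-subst S h))
  , (λ q h → proj₁ (fromInj₁ (λ ()) (PVarIn-subst S h)))
  , (λ h → [ (λ (_ , p≢p) → p≢p refl) , (λ ()) ]′ (PVarIn-subst S h))
  , F⊆S
  , fixed-point-criterion F-box S[F]-box agree
  where
  F : Formula
  F = S [ p ≔ ⊤ᶠ ]

  F-box : QGL⊢ (F ⇒ □ F)
  F-box = Σ-self-boxing (Σ-subst σS)

  S[F]-box : QGL⊢ ((S [ p ≔ F ]) ⇒ □ (S [ p ≔ F ]))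
  S[F]-box = Σ-self-boxing (Σ-subst σS)

  F⊆S : ∀ x → x ∈FV F → x ∈FV S
  F⊆S x h = fromInj₁ (λ ()) (∈FV-subst S h)

  noCapture : NoCapture (F ∧ᶠ □ F) S
  noCapture x b (∧ˡ k) = clean x (F⊆S x k) b
  noCapture x b (∧ʳ (□ k)) = clean x (F⊆S x k) b

  -- Under F ∧ □F, p may be replaced by F instead of ⊤.
  agree : QGL⊢ (□ F ⇒ ((S [ p ≔ F ]) ⇔ F))
  agree = ⇒-trans □-strengthen (replaceΣ S σS noCapture)
    where
    open Replacement p ∧□-self-boxing (tautology ((α ⋀ β) ⊃ (α ≡ˢ ⊤ˢ)) (F ∷ □ F ∷ []))
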